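{- Let $G$ be a connected stepwise irregular graph with maximum degree $\Delta(G)$ and minimum degree $\delta(G)$. Then for every integer $k$ with $\delta(G)\le k\le\Delta(G)$ there is a vertex of $G$ of degree $k$.
   Context: All graphs are finite and simple. A graph $G$ is stepwise irregular (SI) if for every edge $uv\in E(G)$ one has $|d_G(u)-d_G(v)|=1$, where $d_G$ denotes degree. -}

module Defs where

open import Data.Nat using (ℕ; zero; suc; _+_; _⊔_; _⊓_)
open import Data.Bool using (Bool; true; false)
open import Data.Fin using (Fin)
open import Data.List using (List; []; _∷_; filter; length; foldr; map)
open import Data.List.Base using (allFin)
open import Data.Product using (_×_; ∃-syntax)
open import Relation.Binary.PropositionalEquality using (_≡_)
open import Relation.Nullary using (¬_)
open import Data.Bool using (T)
open import Relation.Nullary.Decidable using (Dec)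
open import Data.Bool.Properties using (T?)

record Graph (n : ℕ) : Set where
  field
    adj   : Fin n → Fin n → Bool
    sym   : ∀ u v → adj u v ≡ adj v u
    irrefl : ∀ v → adj v v ≡ false
open Graph public

Adj : ∀ {n} → Graph n → Fin n → Fin n → Set
Adj G u v = T (adj G u v)

deg : ∀ {n} → Graph n → Fin n → ℕ
deg {n} G v = length (filter (λ u → T? (adj G v u)) (allFin n))

data Walk {n} (G : Graph n) : Fin n → Fin n → Set where
  here : ∀ {v} → Walk G v v
  step : ∀ {u v w} → Adj G u v → Walk G v w → Walk G u w

Connected : ∀ {n} → Graph n → Set
Connected G = ∀ u v → Walk G u v

StepwiseIrregular : ∀ {n} → Graph n → Set
StepwiseIrregular G = ∀ u v → Adj G u v →
  (deg G u ≡ suc (deg G v)) Data.Sum.⊎ (deg G v ≡ suc (deg G u))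
  where import Data.Sum

maxDeg : ∀ {m} → Graph (suc m) → ℕ
maxDeg {m} G = foldr (λ v r → deg G v ⊔ r) (deg G Fin.zero) (allFin (suc m))
  where import Data.Fin as Fin

minDeg : ∀ {m} → Graph (suc m) → ℕ
minDeg {m} G = foldr (λ v r → deg G v ⊓ r) (deg G Fin.zero) (allFin (suc m))
  where import Data.Fin as Fin

module Submission where

-- In a stepwise irregular graph the degrees of adjacent vertices differ by
-- exactly one, so along any walk the degree never jumps up by more than one.
-- Any integer-valued vertex function with this "no upward jump" property
-- takes every value between its value at the start and at the end of a walk
-- (induction on the walk: either the current vertex already has value k, or
-- its value is below k and the next vertex's value is still at most k).
-- The minimum and maximum degree are folds of the selective operations ⊓
-- and ⊔, hence both are attained at some vertex; connectivity supplies a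
-- walk from a vertex of minimum degree to one of maximum degree, and the
-- intermediate value theorem along that walk gives the theorem.

open import Defs hiding (sym)
open import Data.Nat using (ℕ; suc; _≤_; _⊓_; _⊔_)
open import Data.Nat.Properties using (⊓-sel; ⊔-sel; ≤-antisym; ≤∧≢⇒<; ≤-trans; n≤1+n; ≤-refl; _≟_)
open import Data.Fin using (Fin; zero)
open import Data.List using (List; []; _∷_; foldr; allFin)
open import Data.Product using (∃-syntax; _,_)
open import Data.Sum using (_⊎_; inj₁; inj₂)
open import Relation.Nullary using (yes; no)
open import Relation.Binary.PropositionalEquality using (_≡_; refl; sym; trans; subst)

foldr-selective-attained : ∀ {a b} {A : Set a} {B : Set b}
  (_∙_ : B → B → B) → (∀ x y → (x ∙ y ≡ x) ⊎ (x ∙ y ≡ y)) →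
  (f : A → B) (z : A) (xs : List A) →
  ∃[ v ] f v ≡ foldr (λ x r → f x ∙ r) (f z) xs
foldr-selective-attained _∙_ sel f z [] = z , refl
foldr-selective-attained _∙_ sel f z (x ∷ xs)
  with sel (f x) (foldr (λ y r → f y ∙ r) (f z) xs)
... | inj₁ first = x , sym first
... | inj₂ rest with foldr-selective-attained _∙_ sel f z xs
...   | v , fv≡fold = v , trans fv≡fold (sym rest)

minDeg-attained : ∀ {m} (G : Graph (suc m)) → ∃[ v ] deg G v ≡ minDeg G
minDeg-attained {m} G = foldr-selective-attained _⊓_ ⊓-sel (deg G) zero (allFin (suc m))

maxDeg-attained : ∀ {m} (G : Graph (suc m)) → ∃[ v ] deg G v ≡ maxDeg G
maxDeg-attained {m} G = foldr-selective-attained _⊔_ ⊔-sel (deg G) zero (allFin (suc m))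

NoUpwardJump : ∀ {n} → Graph n → (Fin n → ℕ) → Set
NoUpwardJump G f = ∀ u v → Adj G u v → f v ≤ suc (f u)

stepwiseIrregular⇒noUpwardJump : ∀ {n} (G : Graph n) →
  StepwiseIrregular G → NoUpwardJump G (deg G)
stepwiseIrregular⇒noUpwardJump G si u v uv with si u v uv
... | inj₁ du≡1+dv = ≤-trans (subst (deg G v ≤_) (sym du≡1+dv) (n≤1+n _)) (n≤1+n _)
... | inj₂ dv≡1+du = subst (_≤ suc (deg G u)) (sym dv≡1+du) ≤-refl

walk-intermediate-value : ∀ {n} (G : Graph n) (f : Fin n → ℕ) →
  NoUpwardJump G f → ∀ k {u w} → Walk G u w →
  f u ≤ k → k ≤ f w → ∃[ v ] f v ≡ k
walk-intermediate-value G f jump k {u} here fu≤k k≤fw = u , ≤-antisym fu≤k k≤fw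
walk-intermediate-value G f jump k {u} (step {v = v} uv walk) fu≤k k≤fw with f u ≟ k
... | yes fu≡k = u , fu≡k
... | no fu≢k = walk-intermediate-value G f jump k walk fv≤k k≤fw
  where
  fv≤k : f v ≤ k
  fv≤k = ≤-trans (jump u v uv) (≤∧≢⇒< fu≤k fu≢k)

mainTheorem11 : ∀ {m} (G : Graph (suc m)) → Connected G → StepwiseIrregular G →
    ∀ (k : ℕ) → minDeg G ≤ k → k ≤ maxDeg G → ∃[ v ] deg G v ≡ k
mainTheorem11 G conn si k δ≤k k≤Δ with minDeg-attained G | maxDeg-attained G
... | a , da≡δ | b , db≡Δ =
  walk-intermediate-value G (deg G) (stepwiseIrregular⇒noUpwardJump G si) k (conn a b)
    (subst (_≤ k) (sym da≡δ) δ≤k) (subst (k ≤_) (sym db≡Δ) k≤Δ)
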